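{- Let $r \ge k > p > 1$ be integers. Then the limit $\lim_{m\to\infty} d_{p,r}^k(m)/m^{(p-1)/(k-1)}$ (over integers $m$) exists and $$\lim_{m \to \infty} \frac{d_{p,r}^k(m)}{m^{\frac{p-1}{k-1}}} = \binom{r-1}{p-1}\binom{r-1}{k-1}^{ -\frac{p-1}{k-1}}.$$
   Context: The Turán graph $T_{n,r}$ partitions $n$ vertices into $r$ parts as evenly as possible, with two vertices adjacent exactly when in different parts; $\binom{n}{k}_r$ denotes the number of $k$-vertex cliques of $T_{n,r}$. For $m > 0$, $j_k^r(m)$ is the unique integer with $\binom{j_k^r(m)}{k-1}_{r-1} \le m < \binom{j_k^r(m)+1}{k-1}_{r-1}$, and $d_{p,r}^k$ is defined on integers $m \ge 0$ by $d_{p,r}^k(0) = 0$ and $d_{p,r}^k(m) = \binom{j_k^r(m)}{p-1}_{r-1} + d_{p,r}^k\!\left(m - \binom{j_k^r(m)}{k-1}_{r-1}\right)$ for $m > 0$. -}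

module Defs where

open import Data.Nat using (ℕ; zero; suc; _+_; _*_; _∸_; _^_; _<ᵇ_; _%_)
open import Data.Nat.Combinatorics using (_C_)
open import Data.Bool using (Bool; true; false; if_then_else_)
open import Data.List using (List; []; _∷_; upTo)
open import Data.Bool.ListAction using (any)
open import Data.Nat using (_≡ᵇ_)
open import Data.Integer using (+_)
open import Data.Rational using (ℚ; 0ℚ; _/_)

-- Turán graph T_{n,r}: vertex set {0,…,n-1}; vertex v lies in part (v mod r).
-- These residue classes partition the vertices into r parts whose sizes
-- differ by at most one ("as evenly as possible").  Two vertices are adjacent
-- iff they lie in different parts.  (r = 0 is degenerate and never used.)
part : ℕ → ℕ → ℕ
part zero    v = zero
part (suc r) v = v % suc r

cliqueCount : ℕ → ℕ → List ℕ → List ℕ → ℕ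
cliqueCount r zero    vs       ps = 1
cliqueCount r (suc k) []       ps = 0
cliqueCount r (suc k) (v ∷ vs) ps =
  (if any (λ q → q ≡ᵇ part r v) ps then 0
   else cliqueCount r k vs (part r v ∷ ps))
  + cliqueCount r (suc k) vs ps

-- turan n k r = (n choose k)_r = number of k-vertex cliques of T_{n,r}.
turan : ℕ → ℕ → ℕ → ℕ
turan n k r = cliqueCount r k (upTo n) []

-- j_k^r(m): the unique j with (j choose k-1)_{r-1} ≤ m < (j+1 choose k-1)_{r-1}.
-- Computed as the least j with m < (j+1 choose k-1)_{r-1}, searching upward
-- from 0 with fuel m + k (enough whenever r ≥ k ≥ 2, the only case used).
jAux : ℕ → ℕ → ℕ → ℕ → ℕ → ℕ
jAux k r m zero       j = j
jAux k r m (suc fuel) j =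
  if m <ᵇ turan (suc j) (k ∸ 1) (r ∸ 1) then j else jAux k r m fuel (suc j)

jfun : ℕ → ℕ → ℕ → ℕ
jfun k r m = jAux k r m (m + k) 0

-- d_{p,r}^k(m), via the defining recursion; fuel m suffices since each
-- step with m > 0 subtracts (j choose k-1)_{r-1} ≥ 1.
dAux : ℕ → ℕ → ℕ → ℕ → ℕ → ℕ
dAux p r k zero       m       = 0
dAux p r k (suc fuel) zero    = 0
dAux p r k (suc fuel) (suc m) =
  turan (jfun k r (suc m)) (p ∸ 1) (r ∸ 1)
  + dAux p r k fuel (suc m ∸ turan (jfun k r (suc m)) (k ∸ 1) (r ∸ 1))

dfun : ℕ → ℕ → ℕ → ℕ → ℕ
dfun p r k m = dAux p r k m m

-- a / b as a rational (b = 0 gives 0; only used with b > 0).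
ratio : ℕ → ℕ → ℚ
ratio a zero    = 0ℚ
ratio a (suc b) = (+ a) / suc b

{-# OPTIONS --safe #-}
module Submission where

-- Write s = r − 1, a = k − 1, b = p − 1. The number of i-cliques of T_{n,s} is the elementary symmetric
-- polynomial e_i of its part sizes, which are q or q + 1 where q = ⌊n / s⌋; hence it lies between
-- (s choose i) q^i and (s choose i) (q + 1)^i. One step of the recursion for d = d_{p,r}^k, with j = j_k^r(m),
-- removes x = (j choose a)_s ≈ A q^a from m and adds y = (j choose b)_s ≈ B q^b, where A = (s choose a),
-- B = (s choose b). The remainder m − x is less than the number of a-cliques through one further vertex, which
-- is O(q^(a−1)); so the index of the remainder is o(q), and by a crude bound d(m) = O((1 + q)^b) its
-- contribution to d is o(q^b). Hence d(m) ~ B q^b and m ~ A q^a, that is d(m)^a / m^b → B^a / A^b.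

open import Defs
open import Data.Bool using (true; false; T; if_then_else_)
open import Data.Bool.ListAction using (any)
import Data.Bool.Properties as Bool
open import Data.Empty using (⊥; ⊥-elim)
open import Data.Integer using (+[1+_]; +0; -[1+_]; +<+)
open import Data.List using (List; []; _∷_; _++_; _∷ʳ_; length; replicate; upTo)
open import Data.List.Properties using (length-replicate; upTo-∷ʳ; ++-identityʳ)
open import Data.List.Relation.Binary.Pointwise as Pointwise using (Pointwise; []; _∷_)
open import Data.Nat hiding (∣_-_∣)
open import Data.Nat.Combinatorics using (_C_; nCk+nC[k+1]≡[n+1]C[k+1]; k>n⇒nCk≡0; nCk≡nC[n∸k]; nCn≡1)
open import Data.Nat.Coprimality using (Coprime)
open import Data.Nat.DivMod using (m%n<n; [m+kn]%n≡m%n; m<n⇒m%n≡m)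
open import Data.Nat.Induction using (<-rec)
open import Data.Nat.Properties
open import Data.Nat.Tactic.RingSolver using (solve-∀)
open import Data.Product using (_×_; _,_; proj₁; proj₂; ∃-syntax)
open import Data.Rational using (ℚ; 0ℚ; mkℚ; ∣_∣; _-_; *<*) renaming (_<_ to _<ℚ_)
open import Data.Sum using (_⊎_; inj₁; inj₂)
open import Function using (_∘_)
open import Relation.Binary.PropositionalEquality
open import Relation.Nullary using (yes; no)
open import Algebra.Properties.CommutativeSemigroup *-commutativeSemigroup
  using (interchange; x∙yz≈y∙xz; xy∙z≈xz∙y; xy∙z≈y∙xz)

-- Elementary symmetric polynomials

esym : ℕ → List ℕ → ℕ
esym zero    xs       = 1
esym (suc k) []       = 0
esym (suc k) (x ∷ xs) = x * esym k xs + esym (suc k) xs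

incAt : ℕ → List ℕ → List ℕ
incAt _       []       = []
incAt zero    (x ∷ xs) = suc x ∷ xs
incAt (suc i) (x ∷ xs) = x ∷ incAt i xs

clearAt : ℕ → List ℕ → List ℕ
clearAt _       []       = []
clearAt zero    (x ∷ xs) = 0 ∷ xs
clearAt (suc i) (x ∷ xs) = x ∷ clearAt i xs

length-incAt : ∀ i xs → length (incAt i xs) ≡ length xs
length-incAt _       []       = refl
length-incAt zero    (x ∷ xs) = refl
length-incAt (suc i) (x ∷ xs) = cong suc (length-incAt i xs)

incAt-comm : ∀ i j xs → incAt i (incAt j xs) ≡ incAt j (incAt i xs)
incAt-comm _       _       []       = refl
incAt-comm zero    zero    (x ∷ xs) = refl
incAt-comm zero    (suc j) (x ∷ xs) = refl
incAt-comm (suc i) zero    (x ∷ xs) = refl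
incAt-comm (suc i) (suc j) (x ∷ xs) = cong (x ∷_) (incAt-comm i j xs)

clearAt-incAt : ∀ i xs → clearAt i (incAt i xs) ≡ clearAt i xs
clearAt-incAt _       []       = refl
clearAt-incAt zero    (x ∷ xs) = refl
clearAt-incAt (suc i) (x ∷ xs) = cong (x ∷_) (clearAt-incAt i xs)

clearAt-incAt-≢ : ∀ i j xs → i ≢ j → clearAt i (incAt j xs) ≡ incAt j (clearAt i xs)
clearAt-incAt-≢ _       _       []       _   = refl
clearAt-incAt-≢ zero    zero    (x ∷ xs) i≢j = ⊥-elim (i≢j refl)
clearAt-incAt-≢ zero    (suc j) (x ∷ xs) _   = refl
clearAt-incAt-≢ (suc i) zero    (x ∷ xs) _   = refl
clearAt-incAt-≢ (suc i) (suc j) (x ∷ xs) i≢j =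
  cong (x ∷_) (clearAt-incAt-≢ i j xs (i≢j ∘ cong suc))

clearAt-replicate-0 : ∀ i n → clearAt i (replicate n 0) ≡ replicate n 0
clearAt-replicate-0 _       zero    = refl
clearAt-replicate-0 zero    (suc n) = refl
clearAt-replicate-0 (suc i) (suc n) = cong (0 ∷_) (clearAt-replicate-0 i n)

esym-0∷ : ∀ k xs → esym k (0 ∷ xs) ≡ esym k xs
esym-0∷ zero    xs = refl
esym-0∷ (suc k) xs = refl

esym-replicate-0 : ∀ k n → esym (suc k) (replicate n 0) ≡ 0
esym-replicate-0 k zero    = refl
esym-replicate-0 k (suc n) = esym-replicate-0 k n

esym-incAt : ∀ k i xs → i < length xs →
             esym (suc k) (incAt i xs) ≡ esym (suc k) xs + esym k (clearAt i xs)
esym-incAt k zero (x ∷ xs) _ = begin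
  esym k xs + x * esym k xs + esym (suc k) xs   ≡⟨ shuffle (esym k xs) _ _ ⟩
  x * esym k xs + esym (suc k) xs + esym k xs   ≡⟨ cong (x * esym k xs + esym (suc k) xs +_) (esym-0∷ k xs) ⟨
  x * esym k xs + esym (suc k) xs + esym k (0 ∷ xs) ∎
  where
  open ≡-Reasoning
  shuffle : ∀ e f g → e + f + g ≡ f + g + e
  shuffle = solve-∀
esym-incAt zero (suc i) (x ∷ xs) (s≤s i<n)
  rewrite esym-incAt zero i xs i<n = sym (+-assoc (x * 1) (esym 1 xs) 1)
esym-incAt (suc k) (suc i) (x ∷ xs) (s≤s i<n)
  rewrite esym-incAt (suc k) i xs i<n | esym-incAt k i xs i<n = shuffle x _ _ _ _
  where
  shuffle : ∀ x e f g h → x * (e + f) + (g + h) ≡ x * e + g + (x * f + h)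
  shuffle = solve-∀

esym-mono : ∀ k {xs ys} → Pointwise _≤_ xs ys → esym k xs ≤ esym k ys
esym-mono zero    _            = ≤-refl
esym-mono (suc k) []           = ≤-refl
esym-mono (suc k) (x≤y ∷ xs≤ys) = +-mono-≤ (*-mono-≤ x≤y (esym-mono k xs≤ys)) (esym-mono (suc k) xs≤ys)

nC0≡1 : ∀ n → n C 0 ≡ 1
nC0≡1 n = trans (nCk≡nC[n∸k] (z≤n {n})) (nCn≡1 n)

n≤k⇒nCk≤1 : ∀ {n k} → n ≤ k → n C k ≤ 1
n≤k⇒nCk≤1 {n} n≤k with m≤n⇒m<n∨m≡n n≤k
... | inj₁ n<k  = ≤-trans (≤-reflexive (k>n⇒nCk≡0 n<k)) z≤n
... | inj₂ refl = ≤-reflexive (nCn≡1 n)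

k≤n⇒nCk>0 : ∀ {n k} → k ≤ n → 1 ≤ n C k
k≤n⇒nCk>0 {n}     {zero}  _         = ≤-reflexive (sym (nC0≡1 n))
k≤n⇒nCk>0 {suc n} {suc k} (s≤s k≤n) = subst (1 ≤_) (nCk+nC[k+1]≡[n+1]C[k+1] n k) (≤-trans (k≤n⇒nCk>0 k≤n) (m≤m+n _ _))

esym-replicate : ∀ n k x → esym k (replicate n x) ≡ (n C k) * x ^ k
esym-replicate n zero x = sym (cong (_* 1) (nC0≡1 n))
esym-replicate zero (suc k) x = refl
esym-replicate (suc n) (suc k) x
  rewrite esym-replicate n k x | esym-replicate n (suc k) x = begin
  x * ((n C k) * x ^ k) + (n C suc k) * (x * x ^ k)  ≡⟨ shuffle x (n C k) _ (x ^ k) ⟩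
  (n C k + n C suc k) * (x * x ^ k)                 ≡⟨ cong (_* (x * x ^ k)) (nCk+nC[k+1]≡[n+1]C[k+1] n k) ⟩
  (suc n C suc k) * (x * x ^ k)                     ∎
  where
  open ≡-Reasoning
  shuffle : ∀ x c c′ y → x * (c * y) + c′ * (x * y) ≡ (c + c′) * (x * y)
  shuffle = solve-∀

nonzeros : List ℕ → ℕ
nonzeros []           = 0
nonzeros (zero  ∷ xs) = nonzeros xs
nonzeros (suc _ ∷ xs) = suc (nonzeros xs)

nonzeros-++ : ∀ xs ys → nonzeros (xs ++ ys) ≡ nonzeros xs + nonzeros ys
nonzeros-++ []           ys = refl
nonzeros-++ (zero  ∷ xs) ys = nonzeros-++ xs ys
nonzeros-++ (suc _ ∷ xs) ys = cong suc (nonzeros-++ xs ys)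

nonzeros-replicate-suc : ∀ n x → nonzeros (replicate n (suc x)) ≡ n
nonzeros-replicate-suc zero    x = refl
nonzeros-replicate-suc (suc n) x = cong suc (nonzeros-replicate-suc n x)

nonzeros-replicate-0 : ∀ n → nonzeros (replicate n 0) ≡ 0
nonzeros-replicate-0 zero    = refl
nonzeros-replicate-0 (suc n) = nonzeros-replicate-0 n

nonzeros-incAt : ∀ i xs → nonzeros (incAt i xs) ≤ suc (nonzeros xs)
nonzeros-incAt _       []           = z≤n
nonzeros-incAt zero    (zero  ∷ xs) = ≤-refl
nonzeros-incAt zero    (suc _ ∷ xs) = n≤1+n _
nonzeros-incAt (suc i) (zero  ∷ xs) = nonzeros-incAt i xs
nonzeros-incAt (suc i) (suc _ ∷ xs) = s≤s (nonzeros-incAt i xs)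

esym-pos : ∀ k xs → k ≤ nonzeros xs → 1 ≤ esym k xs
esym-pos zero    xs           _         = ≤-refl
esym-pos (suc k) (zero  ∷ xs) k<n       = esym-pos (suc k) xs k<n
esym-pos (suc k) (suc x ∷ xs) (s≤s k≤n) =
  ≤-trans (esym-pos k xs k≤n) (≤-trans (m≤m+n _ (x * esym k xs)) (m≤m+n _ _))

esym-≤1 : ∀ k {xs} n → Pointwise _≤_ xs (replicate n 1) → esym k xs ≡ nonzeros xs C k
esym-≤1 zero    {xs} n _ = sym (nC0≡1 (nonzeros xs))
esym-≤1 (suc k) zero    [] = refl
esym-≤1 (suc k) (suc n) (z≤n ∷ xs≤1) = esym-≤1 (suc k) n xs≤1
esym-≤1 (suc k) {1 ∷ xs} (suc n) (s≤s z≤n ∷ xs≤1)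
  rewrite esym-≤1 k n xs≤1 | esym-≤1 (suc k) n xs≤1 =
  trans (cong (_+ nonzeros xs C suc k) (+-identityʳ _)) (nCk+nC[k+1]≡[n+1]C[k+1] (nonzeros xs) k)

replicate-++ : ∀ m n (x : ℕ) → replicate m x ++ replicate n x ≡ replicate (m + n) x
replicate-++ zero    n x = refl
replicate-++ (suc m) n x = cong (x ∷_) (replicate-++ m n x)

replicate-++-∷ : ∀ t (y : ℕ) zs → replicate t y ++ y ∷ zs ≡ replicate (suc t) y ++ zs
replicate-++-∷ zero    y zs = refl
replicate-++-∷ (suc t) y zs = cong (y ∷_) (replicate-++-∷ t y zs)

incAt-replicate-++ : ∀ t y z zs → incAt t (replicate t y ++ z ∷ zs) ≡ replicate t y ++ suc z ∷ zs
incAt-replicate-++ zero    y z zs = refl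
incAt-replicate-++ (suc t) y z zs = cong (y ∷_) (incAt-replicate-++ t y z zs)

clearAt-replicate-++ : ∀ t y z zs → clearAt t (replicate t y ++ z ∷ zs) ≡ replicate t y ++ 0 ∷ zs
clearAt-replicate-++ zero    y z zs = refl
clearAt-replicate-++ (suc t) y z zs = cong (y ∷_) (clearAt-replicate-++ t y z zs)

incAt-≤-replicate : ∀ i {xs y} n → Pointwise _≤_ xs (replicate n y) →
                    Pointwise _≤_ (incAt i xs) (replicate n (suc y))
incAt-≤-replicate i       zero    []           = []
incAt-≤-replicate zero    (suc n) (x≤y ∷ xs≤y) =
  s≤s x≤y ∷ Pointwise.transitive ≤-trans xs≤y (Pointwise.replicate⁺ (n≤1+n _) n)
incAt-≤-replicate (suc i) (suc n) (x≤y ∷ xs≤y) = m≤n⇒m≤1+n x≤y ∷ incAt-≤-replicate i n xs≤y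

clearAt-≤ : ∀ i xs → Pointwise _≤_ (clearAt i xs) xs
clearAt-≤ _       []       = []
clearAt-≤ zero    (x ∷ xs) = z≤n ∷ Pointwise.refl ≤-refl
clearAt-≤ (suc i) (x ∷ xs) = ≤-refl ∷ clearAt-≤ i xs

-- Part sizes and clique counts of Turán graphs

module PartSizes (s₀ : ℕ) where

  s : ℕ
  s = suc s₀

  part<s : ∀ v → part s v < s
  part<s v = m%n<n v s

  sizesAvoiding : List ℕ → List ℕ → List ℕ
  sizesAvoiding []       ps = replicate s 0
  sizesAvoiding (v ∷ vs) ps =
    if any (λ p → p ≡ᵇ part s v) ps then sizesAvoiding vs ps
    else incAt (part s v) (sizesAvoiding vs ps)

  length-sizesAvoiding : ∀ vs ps → length (sizesAvoiding vs ps) ≡ s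
  length-sizesAvoiding []       ps = length-replicate s
  length-sizesAvoiding (v ∷ vs) ps with any (λ p → p ≡ᵇ part s v) ps
  ... | true  = length-sizesAvoiding vs ps
  ... | false = trans (length-incAt (part s v) (sizesAvoiding vs ps)) (length-sizesAvoiding vs ps)

  part<length : ∀ v vs ps → part s v < length (sizesAvoiding vs ps)
  part<length v vs ps = subst (part s v <_) (sym (length-sizesAvoiding vs ps)) (part<s v)

  sizesAvoiding-∷ : ∀ p vs ps → sizesAvoiding vs (p ∷ ps) ≡ clearAt p (sizesAvoiding vs ps)
  sizesAvoiding-∷ p []       ps = sym (clearAt-replicate-0 p s)
  sizesAvoiding-∷ p (v ∷ vs) ps with any (λ q → q ≡ᵇ part s v) ps
  ... | true  rewrite Bool.∨-zeroʳ (p ≡ᵇ part s v) = sizesAvoiding-∷ p vs ps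
  ... | false rewrite Bool.∨-identityʳ (p ≡ᵇ part s v) with p ≡ᵇ part s v in p≡ᵇv
  ...   | true  rewrite ≡ᵇ⇒≡ p (part s v) (subst T (sym p≡ᵇv) _) =
          trans (sizesAvoiding-∷ (part s v) vs ps) (sym (clearAt-incAt (part s v) (sizesAvoiding vs ps)))
  ...   | false =
          trans (cong (incAt (part s v)) (sizesAvoiding-∷ p vs ps))
                (sym (clearAt-incAt-≢ p (part s v) (sizesAvoiding vs ps) (subst T p≡ᵇv ∘ ≡⇒≡ᵇ p (part s v))))

  cliqueCount≡esym : ∀ k vs ps → cliqueCount s k vs ps ≡ esym k (sizesAvoiding vs ps)
  cliqueCount≡esym zero    vs       ps = refl
  cliqueCount≡esym (suc k) []       ps = sym (esym-replicate-0 k s)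
  cliqueCount≡esym (suc k) (v ∷ vs) ps with any (λ q → q ≡ᵇ part s v) ps
  ... | true  = cliqueCount≡esym (suc k) vs ps
  ... | false = begin
    cliqueCount s k vs (part s v ∷ ps) + cliqueCount s (suc k) vs ps
      ≡⟨ cong₂ _+_ (cliqueCount≡esym k vs _) (cliqueCount≡esym (suc k) vs ps) ⟩
    esym k (sizesAvoiding vs (part s v ∷ ps)) + esym (suc k) (sizesAvoiding vs ps)
      ≡⟨ cong (λ xs → esym k xs + _) (sizesAvoiding-∷ (part s v) vs ps) ⟩
    esym k (clearAt (part s v) (sizesAvoiding vs ps)) + esym (suc k) (sizesAvoiding vs ps)
      ≡⟨ +-comm (esym k (clearAt (part s v) (sizesAvoiding vs ps))) _ ⟩
    esym (suc k) (sizesAvoiding vs ps) + esym k (clearAt (part s v) (sizesAvoiding vs ps))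
      ≡⟨ esym-incAt k (part s v) _ (part<length v vs ps) ⟨
    esym (suc k) (incAt (part s v) (sizesAvoiding vs ps)) ∎
    where open ≡-Reasoning

  sizes : ℕ → List ℕ
  sizes n = sizesAvoiding (upTo n) []

  sizesAvoiding-∷ʳ : ∀ vs v → sizesAvoiding (vs ∷ʳ v) [] ≡ incAt (part s v) (sizesAvoiding vs [])
  sizesAvoiding-∷ʳ []       v = refl
  sizesAvoiding-∷ʳ (w ∷ vs) v =
    trans (cong (incAt (part s w)) (sizesAvoiding-∷ʳ vs v)) (incAt-comm (part s w) (part s v) (sizesAvoiding vs []))

  sizes-suc : ∀ n → sizes (suc n) ≡ incAt (part s n) (sizes n)
  sizes-suc n = trans (cong (λ vs → sizesAvoiding vs []) (sym (upTo-∷ʳ n))) (sizesAvoiding-∷ʳ (upTo n) n)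

  turan≡esym : ∀ n k → turan n k s ≡ esym k (sizes n)
  turan≡esym n k = cliqueCount≡esym k (upTo n) []

  -- The (k+1)-cliques of T_{n+1,s} that contain the new vertex n.
  cliquesAt : ℕ → ℕ → ℕ
  cliquesAt n k = esym k (clearAt (part s n) (sizes n))

  turan-suc : ∀ n k → turan (suc n) (suc k) s ≡ turan n (suc k) s + cliquesAt n k
  turan-suc n k = begin
    turan (suc n) (suc k) s                      ≡⟨ turan≡esym (suc n) (suc k) ⟩
    esym (suc k) (sizes (suc n))                 ≡⟨ cong (esym (suc k)) (sizes-suc n) ⟩
    esym (suc k) (incAt (part s n) (sizes n))    ≡⟨ esym-incAt k (part s n) (sizes n) (part<length n (upTo n) []) ⟩
    esym (suc k) (sizes n) + cliquesAt n k       ≡⟨ cong (_+ cliquesAt n k) (turan≡esym n (suc k)) ⟨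
    turan n (suc k) s + cliquesAt n k            ∎
    where open ≡-Reasoning

  record Balanced (n : ℕ) : Set where
    field
      q t    : ℕ
      t<s    : t < s
      n≡     : n ≡ t + q * s
      sizes≡ : sizes n ≡ replicate t (suc q) ++ replicate (s ∸ t) q

  module _ {n} (b : Balanced n) where
    open Balanced b

    part-balanced : part s n ≡ t
    part-balanced = begin
      (n % s)         ≡⟨ cong (_% s) n≡ ⟩
      (t + q * s) % s ≡⟨ [m+kn]%n≡m%n t q s ⟩
      t % s           ≡⟨ m<n⇒m%n≡m t<s ⟩
      t               ∎
      where open ≡-Reasoning

    s∸t≡suc : s ∸ t ≡ suc (s₀ ∸ t)
    s∸t≡suc = +-∸-assoc 1 (≤-pred t<s)

    sizes-suc-balanced : sizes (suc n) ≡ replicate (suc t) (suc q) ++ replicate (s₀ ∸ t) q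
    sizes-suc-balanced = begin
      sizes (suc n)
        ≡⟨ sizes-suc n ⟩
      incAt (part s n) (sizes n)
        ≡⟨ cong₂ incAt part-balanced sizes≡ ⟩
      incAt t (replicate t (suc q) ++ replicate (s ∸ t) q)
        ≡⟨ cong (λ u → incAt t (replicate t (suc q) ++ replicate u q)) s∸t≡suc ⟩
      incAt t (replicate t (suc q) ++ q ∷ replicate (s₀ ∸ t) q)
        ≡⟨ incAt-replicate-++ t (suc q) q _ ⟩
      replicate t (suc q) ++ suc q ∷ replicate (s₀ ∸ t) q
        ≡⟨ replicate-++-∷ t (suc q) _ ⟩
      replicate (suc t) (suc q) ++ replicate (s₀ ∸ t) q
        ∎
      where open ≡-Reasoning

    -- Vertex n joins part t; when t is the last part, every part now has q + 1 vertices.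
    balanced-suc : Balanced (suc n)
    balanced-suc with suc t <? s
    ... | yes t+1<s = record
      { q = q ; t = suc t ; t<s = t+1<s ; n≡ = cong suc n≡ ; sizes≡ = sizes-suc-balanced }
    ... | no  t+1≮s = record
      { q = suc q ; t = 0 ; t<s = s≤s z≤n
      ; n≡ = trans (cong suc n≡) (cong (_+ q * s) t+1≡s)
      ; sizes≡ = sizes≡′ }
      where
      t+1≡s : suc t ≡ s
      t+1≡s = ≤-antisym t<s (≮⇒≥ t+1≮s)

      sizes≡′ : sizes (suc n) ≡ replicate s (suc q)
      sizes≡′ = begin
        sizes (suc n)
          ≡⟨ sizes-suc-balanced ⟩
        replicate (suc t) (suc q) ++ replicate (s₀ ∸ t) q
          ≡⟨ cong (λ u → replicate (suc u) (suc q) ++ replicate (s₀ ∸ u) q) (suc-injective t+1≡s) ⟩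
        replicate s (suc q) ++ replicate (s₀ ∸ s₀) q
          ≡⟨ cong (λ u → replicate s (suc q) ++ replicate u q) (n∸n≡0 s₀) ⟩
        replicate s (suc q) ++ []
          ≡⟨ ++-identityʳ _ ⟩
        replicate s (suc q)
          ∎
        where open ≡-Reasoning

    replicate-split : ∀ x → replicate s x ≡ replicate t x ++ replicate (s ∸ t) x
    replicate-split x = trans (cong (λ u → replicate u x) (sym (m+[n∸m]≡n (<⇒≤ t<s)))) (sym (replicate-++ t (s ∸ t) x))

    sizes-lower : Pointwise _≤_ (replicate s q) (sizes n)
    sizes-lower = subst₂ (Pointwise _≤_) (sym (replicate-split q)) (sym sizes≡)
      (Pointwise.++⁺ (Pointwise.replicate⁺ (n≤1+n q) t) (Pointwise.refl ≤-refl))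

    sizes-upper : Pointwise _≤_ (sizes n) (replicate s (suc q))
    sizes-upper = subst₂ (Pointwise _≤_) (sym sizes≡) (sym (replicate-split (suc q)))
      (Pointwise.++⁺ (Pointwise.refl ≤-refl) (Pointwise.replicate⁺ (n≤1+n q) (s ∸ t)))

    turan-lower : ∀ k → (s C k) * q ^ k ≤ turan n k s
    turan-lower k = begin
      (s C k) * q ^ k              ≡⟨ esym-replicate s k q ⟨
      esym k (replicate s q)       ≤⟨ esym-mono k sizes-lower ⟩
      esym k (sizes n)             ≡⟨ turan≡esym n k ⟨
      turan n k s                  ∎
      where open ≤-Reasoning

    turan-upper : ∀ k → turan n k s ≤ (s C k) * suc q ^ k
    turan-upper k = begin
      turan n k s                  ≡⟨ turan≡esym n k ⟩
      esym k (sizes n)             ≤⟨ esym-mono k sizes-upper ⟩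
      esym k (replicate s (suc q)) ≡⟨ esym-replicate s k (suc q) ⟩
      (s C k) * suc q ^ k          ∎
      where open ≤-Reasoning

    turan-suc-upper : ∀ k → turan (suc n) k s ≤ (s C k) * (2 + q) ^ k
    turan-suc-upper k = begin
      turan (suc n) k s                          ≡⟨ turan≡esym (suc n) k ⟩
      esym k (sizes (suc n))                     ≡⟨ cong (esym k) (sizes-suc n) ⟩
      esym k (incAt (part s n) (sizes n))        ≤⟨ esym-mono k (incAt-≤-replicate (part s n) s sizes-upper) ⟩
      esym k (replicate s (2 + q))               ≡⟨ esym-replicate s k (2 + q) ⟩
      (s C k) * (2 + q) ^ k                      ∎
      where open ≤-Reasoning

    cliquesAt-upper : ∀ k → cliquesAt n k ≤ (s C k) * suc q ^ k
    cliquesAt-upper k = begin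
      cliquesAt n k                ≤⟨ esym-mono k (clearAt-≤ (part s n) (sizes n)) ⟩
      esym k (sizes n)             ≡⟨ turan≡esym n k ⟨
      turan n k s                  ≤⟨ turan-upper k ⟩
      (s C k) * suc q ^ k          ∎
      where open ≤-Reasoning

    nonzeros-cleared : nonzeros (clearAt (part s n) (sizes n)) ≡ t + nonzeros (replicate (s₀ ∸ t) q)
    nonzeros-cleared = begin
      nonzeros (clearAt (part s n) (sizes n))
        ≡⟨ cong₂ (λ i xs → nonzeros (clearAt i xs)) part-balanced sizes≡ ⟩
      nonzeros (clearAt t (replicate t (suc q) ++ replicate (s ∸ t) q))
        ≡⟨ cong (λ u → nonzeros (clearAt t (replicate t (suc q) ++ replicate u q))) s∸t≡suc ⟩
      nonzeros (clearAt t (replicate t (suc q) ++ q ∷ replicate (s₀ ∸ t) q))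
        ≡⟨ cong nonzeros (clearAt-replicate-++ t (suc q) q _) ⟩
      nonzeros (replicate t (suc q) ++ 0 ∷ replicate (s₀ ∸ t) q)
        ≡⟨ nonzeros-++ (replicate t (suc q)) _ ⟩
      nonzeros (replicate t (suc q)) + nonzeros (replicate (s₀ ∸ t) q)
        ≡⟨ cong (_+ nonzeros (replicate (s₀ ∸ t) q)) (nonzeros-replicate-suc t q) ⟩
      t + nonzeros (replicate (s₀ ∸ t) q)
        ∎
      where open ≡-Reasoning

    -- Until every part is occupied the new vertex is adjacent to all n earlier vertices, which lie in distinct parts;
    -- afterwards it is adjacent to every other part.
    cliquesAt-pos : ∀ k → k ≤ n → k < s → 1 ≤ cliquesAt n k
    cliquesAt-pos k k≤n k<s = esym-pos k _ (subst (k ≤_) (sym nonzeros-cleared) (enough q (subst (k ≤_) n≡ k≤n)))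
      where
      enough : ∀ q′ → k ≤ t + q′ * s → k ≤ t + nonzeros (replicate (s₀ ∸ t) q′)
      enough zero    k≤t = subst (λ z → k ≤ t + z) (sym (nonzeros-replicate-0 (s₀ ∸ t))) k≤t
      enough (suc x) _   = begin
        k                                            ≤⟨ ≤-pred k<s ⟩
        s₀                                           ≡⟨ m+[n∸m]≡n (≤-pred t<s) ⟨
        t + (s₀ ∸ t)                                 ≡⟨ cong (t +_) (nonzeros-replicate-suc (s₀ ∸ t) x) ⟨
        t + nonzeros (replicate (s₀ ∸ t) (suc x))    ∎
        where open ≤-Reasoning

  balanced : ∀ n → Balanced n
  balanced zero    = record { q = 0 ; t = 0 ; t<s = s≤s z≤n ; n≡ = refl ; sizes≡ = refl }
  balanced (suc n) = balanced-suc (balanced n)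

  nonzeros-sizes : ∀ n → nonzeros (sizes n) ≤ n
  nonzeros-sizes zero    = ≤-reflexive (nonzeros-replicate-0 s)
  nonzeros-sizes (suc n) = begin
    nonzeros (sizes (suc n))                 ≡⟨ cong nonzeros (sizes-suc n) ⟩
    nonzeros (incAt (part s n) (sizes n))    ≤⟨ nonzeros-incAt (part s n) (sizes n) ⟩
    suc (nonzeros (sizes n))                 ≤⟨ s≤s (nonzeros-sizes n) ⟩
    suc n                                    ∎
    where open ≤-Reasoning

  sizes-≤1 : ∀ {n} → n ≤ s → Pointwise _≤_ (sizes n) (replicate s 1)
  sizes-≤1 {n} n≤s = bound (balanced n)
    where
    bound : Balanced n → Pointwise _≤_ (sizes n) (replicate s 1)
    bound b@record { q = zero } = sizes-upper b
    bound record { q = suc zero ; t = zero ; sizes≡ = sizes≡ } =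
      subst (λ xs → Pointwise _≤_ xs (replicate s 1)) (sym sizes≡) (Pointwise.refl ≤-refl)
    bound record { q = suc zero ; t = suc t ; n≡ = n≡ } = ⊥-elim (<⇒≱ s<n n≤s)
      where
      s<n : s < n
      s<n = begin-strict
        s              ≡⟨ *-identityˡ s ⟨
        1 * s          <⟨ s≤s (m≤n+m (1 * s) t) ⟩
        suc t + 1 * s  ≡⟨ n≡ ⟨
        n              ∎
        where open ≤-Reasoning
    bound record { q = suc (suc q) ; t = t ; n≡ = n≡ } = ⊥-elim (<⇒≱ s<n n≤s)
      where
      s<n : s < n
      s<n = begin-strict
        s                    <⟨ m<m+n s z<s ⟩
        s + s                ≤⟨ +-monoʳ-≤ s (m≤m+n s (q * s)) ⟩
        suc (suc q) * s      ≤⟨ m≤n+m _ t ⟩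
        t + suc (suc q) * s  ≡⟨ n≡ ⟨
        n                    ∎
        where open ≤-Reasoning

-- Eventual inequalities

Eventually : (ℕ → Set) → Set
Eventually P = ∃[ M ] (∀ m → M ≤ m → P m)

eventually-≥ : ∀ M → Eventually (M ≤_)
eventually-≥ M = M , λ _ M≤m → M≤m

eventually-map : ∀ {P Q : ℕ → Set} → (∀ {m} → P m → Q m) → Eventually P → Eventually Q
eventually-map f (M , p) = M , λ m M≤m → f (p m M≤m)

eventually-zip : ∀ {P Q : ℕ → Set} → Eventually P → Eventually Q → Eventually (λ m → P m × Q m)
eventually-zip (M₁ , p) (M₂ , q) =
  M₁ ⊔ M₂ , λ m M≤m → p m (≤-trans (m≤m⊔n M₁ M₂) M≤m) , q m (≤-trans (m≤n⊔m M₁ M₂) M≤m)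

bounded-upTo : ∀ (f : ℕ → ℕ) X → ∃[ D ] (∀ {m} → m ≤ X → f m ≤ D)
bounded-upTo f zero    = f 0 , λ { z≤n → ≤-refl }
bounded-upTo f (suc X) with bounded-upTo f X
... | D , bound = D ⊔ f (suc X) , below
  where
  below : ∀ {m} → m ≤ suc X → f m ≤ D ⊔ f (suc X)
  below m≤1+X with m≤n⇒m<n∨m≡n m≤1+X
  ... | inj₁ (s≤s m≤X) = ≤-trans (bound m≤X) (m≤m⊔n D _)
  ... | inj₂ refl      = m≤n⊔m D _

^-distribʳ-* : ∀ x y n → (x * y) ^ n ≡ x ^ n * y ^ n
^-distribʳ-* x y zero    = refl
^-distribʳ-* x y (suc n) = begin
  x * y * (x * y) ^ n        ≡⟨ cong (x * y *_) (^-distribʳ-* x y n) ⟩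
  x * y * (x ^ n * y ^ n)    ≡⟨ interchange x y (x ^ n) (y ^ n) ⟩
  x * x ^ n * (y * y ^ n)    ∎
  where open ≡-Reasoning

^-pos : ∀ {x} n → 1 ≤ x → 1 ≤ x ^ n
^-pos n 1≤x = m^n>0 _ {{>-nonZero 1≤x}} n

^-+-≥ : ∀ b {x} y → 1 ≤ b → 1 ≤ x → x ^ b + y ≤ (x + y) ^ b
^-+-≥ (suc b) {x} y _ 1≤x = begin
  x * x ^ b + y              ≤⟨ +-monoʳ-≤ (x * x ^ b) (m≤m*n y (x ^ b) {{>-nonZero (^-pos b 1≤x)}}) ⟩
  x * x ^ b + y * x ^ b      ≡⟨ *-distribʳ-+ (x ^ b) x y ⟨
  (x + y) * x ^ b            ≤⟨ *-monoʳ-≤ (x + y) (^-monoˡ-≤ b (m≤m+n x y)) ⟩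
  (x + y) * (x + y) ^ b      ∎
  where open ≤-Reasoning

^-suc-+-≤ : ∀ x h N → (x + h) ^ suc N ≤ x ^ suc N + h * suc N * (x + h) ^ N
^-suc-+-≤ x h zero = ≤-reflexive (identity x h)
  where
  identity : ∀ x h → (x + h) * 1 ≡ x * 1 + h * 1 * 1
  identity = solve-∀
^-suc-+-≤ x h (suc N) = begin
  (x + h) * (x + h) ^ suc N
    ≤⟨ *-monoʳ-≤ (x + h) (^-suc-+-≤ x h N) ⟩
  (x + h) * (x ^ suc N + h * suc N * (x + h) ^ N)
    ≡⟨ expand x h N (x ^ suc N) ((x + h) ^ N) ⟩
  x * x ^ suc N + h * x ^ suc N + h * suc N * (x + h) ^ suc N
    ≤⟨ +-monoˡ-≤ _ (+-monoʳ-≤ (x * x ^ suc N) (*-monoʳ-≤ h (^-monoˡ-≤ (suc N) (m≤m+n x h)))) ⟩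
  x * x ^ suc N + h * (x + h) ^ suc N + h * suc N * (x + h) ^ suc N
    ≡⟨ collect (x * x ^ suc N) h N ((x + h) ^ suc N) ⟩
  x ^ suc (suc N) + h * suc (suc N) * (x + h) ^ suc N
    ∎
  where
  open ≤-Reasoning
  expand : ∀ x h N p r → (x + h) * (p + h * suc N * r) ≡ x * p + h * p + h * suc N * ((x + h) * r)
  expand = solve-∀
  collect : ∀ y h N r → y + h * r + h * suc N * r ≡ y + h * suc (suc N) * r
  collect = solve-∀

-- (x + h)^(N+1) − x^(N+1) ≤ h (N+1) (x + h)^N ≤ h (N+1) 2^N x^N once x ≥ h, and w x^(N+1) eventually exceeds this.
eventually-shift-< : ∀ N c w h → 1 ≤ w → Eventually (λ x → c * (x + h) ^ N < (c + w) * x ^ N)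
eventually-shift-< zero    c w h 1≤w =
  0 , λ x _ → subst₂ _<_ (sym (*-identityʳ c)) (sym (*-identityʳ (c + w))) (m<m+n c 1≤w)
eventually-shift-< (suc N) c w h 1≤w = X , beaten
  where
  K = c * h * suc N * 2 ^ N
  X = suc (h + K)
  beaten : ∀ x → X ≤ x → c * (x + h) ^ suc N < (c + w) * x ^ suc N
  beaten x X≤x = begin-strict
    c * (x + h) ^ suc N
      ≤⟨ *-monoʳ-≤ c (^-suc-+-≤ x h N) ⟩
    c * (x ^ suc N + h * suc N * (x + h) ^ N)
      ≤⟨ *-monoʳ-≤ c (+-monoʳ-≤ (x ^ suc N) (*-monoʳ-≤ (h * suc N) shift≤double)) ⟩
    c * (x ^ suc N + h * suc N * (2 ^ N * x ^ N))
      ≡⟨ regroup c x h N (x ^ N) (2 ^ N) ⟩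
    c * x ^ suc N + K * x ^ N
      <⟨ +-monoʳ-< (c * x ^ suc N) K-term< ⟩
    c * x ^ suc N + w * x ^ suc N
      ≡⟨ *-distribʳ-+ (x ^ suc N) c w ⟨
    (c + w) * x ^ suc N
      ∎
    where
    open ≤-Reasoning
    regroup : ∀ c x h N y z → c * (x * y + h * suc N * (z * y)) ≡ c * (x * y) + c * h * suc N * z * y
    regroup = solve-∀
    shift≤double : (x + h) ^ N ≤ 2 ^ N * x ^ N
    shift≤double = begin
      (x + h) ^ N       ≤⟨ ^-monoˡ-≤ N (+-monoʳ-≤ x (≤-trans (m≤m+n h K) (≤-trans (n≤1+n _) X≤x))) ⟩
      (x + x) ^ N       ≡⟨ cong (λ z → (x + z) ^ N) (+-identityʳ x) ⟨
      (2 * x) ^ N       ≡⟨ ^-distribʳ-* 2 x N ⟩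
      2 ^ N * x ^ N     ∎
    K-term< : K * x ^ N < w * x ^ suc N
    K-term< = begin-strict
      K * x ^ N         <⟨ *-monoˡ-< (x ^ N) {{>-nonZero (^-pos N (≤-trans (s≤s z≤n) X≤x))}}
                                      (<-≤-trans (s≤s (m≤n+m K h)) X≤x) ⟩
      x * x ^ N         ≤⟨ m≤n*m (x * x ^ N) w {{>-nonZero 1≤w}} ⟩
      w * x ^ suc N     ∎

-- Taking (a+1)-th roots, q′ is at most of order q^(a/(a+1)), which is eventually below q / L.
base-gap : ∀ {A K L} a q q′ → 1 ≤ A → 1 ≤ L → L + (2 * L) ^ suc a * K ≤ q →
           A * q′ ^ suc a < K * suc q ^ a → L * suc q′ ≤ suc q
base-gap {A} {K} {L} a q q′ 1≤A 1≤L Q≤q small = ≮⇒≥ (gap q′ small)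
  where
  gap : ∀ q′ → A * q′ ^ suc a < K * suc q ^ a → suc q < L * suc q′ → ⊥
  gap zero    _ q<L = <⇒≱ (subst (suc q <_) (*-identityʳ L) q<L) (≤-trans (m≤m+n L _) (≤-trans Q≤q (n≤1+n q)))
  gap q′@(suc r) small q<Lq′ = <⇒≱ (*-cancelʳ-< (suc q ^ a) _ _ powers<) (≤-trans (m≤n+m _ L) (≤-trans Q≤q (n≤1+n q)))
    where
    1+q≤2Lq′ : suc q ≤ 2 * L * q′
    1+q≤2Lq′ = begin
      suc q          ≤⟨ <⇒≤ q<Lq′ ⟩
      L * suc q′     ≤⟨ *-monoʳ-≤ L (≤-trans (≤-reflexive (+-comm 1 q′)) (+-monoʳ-≤ q′ (s≤s z≤n))) ⟩
      L * (2 * q′)   ≡⟨ swap L q′ ⟩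
      2 * L * q′     ∎
      where
      open ≤-Reasoning
      swap : ∀ L q → L * (2 * q) ≡ 2 * L * q
      swap = solve-∀
    1≤2L : 1 ≤ 2 * L
    1≤2L = ≤-trans 1≤L (m≤m+n L _)
    powers< : suc q * suc q ^ a < (2 * L) ^ suc a * K * suc q ^ a
    powers< = begin-strict
      suc q ^ suc a                              ≤⟨ ^-monoˡ-≤ (suc a) 1+q≤2Lq′ ⟩
      (2 * L * q′) ^ suc a                       ≡⟨ ^-distribʳ-* (2 * L) q′ (suc a) ⟩
      (2 * L) ^ suc a * q′ ^ suc a               ≤⟨ *-monoʳ-≤ ((2 * L) ^ suc a) (m≤n*m (q′ ^ suc a) A {{>-nonZero 1≤A}}) ⟩
      (2 * L) ^ suc a * (A * q′ ^ suc a)         <⟨ *-monoʳ-< ((2 * L) ^ suc a) {{>-nonZero (^-pos (suc a) 1≤2L)}} small ⟩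
      (2 * L) ^ suc a * (K * suc q ^ a)          ≡⟨ *-assoc ((2 * L) ^ suc a) K _ ⟨
      (2 * L) ^ suc a * K * suc q ^ a            ∎
      where open ≤-Reasoning

module RatioBounds where
  open import Algebra.Properties.AbelianGroup using (⁻¹-anti-homo‿-)
  open import Data.Integer as ℤ using (+_)
  import Data.Integer.Properties as ℤ
  import Data.Integer.Tactic.RingSolver as ℤSolver
  open import Data.Rational using (-_; toℚᵘ)
  import Data.Rational.Properties as ℚ
  open import Data.Rational.Unnormalised as ℚᵘ using (mkℚᵘ; *<*)
  import Data.Rational.Unnormalised.Properties as ℚᵘ

  +-*-+ : ∀ a b c → + (a * b * c) ≡ + a ℤ.* + b ℤ.* + c
  +-*-+ a b c = trans (ℤ.pos-* (a * b) c) (cong (ℤ._* + c) (ℤ.pos-* a b))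

  -- Clearing the denominators y+1, r+1 and v+1 turns the claim into an inequality between naturals.
  ratio-ratio-< : ∀ X y P r u₀ v₀ .(c : Coprime (suc u₀) (suc v₀)) →
                  X * suc r * suc v₀ < suc y * (P * suc v₀ + suc u₀ * suc r) →
                  ratio X (suc y) - ratio P (suc r) <ℚ mkℚ +[1+ u₀ ] v₀ c
  ratio-ratio-< X y P r u₀ v₀ c XRv<YPvuR = ℚ.toℚᵘ-cancel-< (ℚᵘ.<-respˡ-≃ (ℚᵘ.≃-sym difference≃) (*<* cleared))
    where
    Y = suc y
    R = suc r
    u = suc u₀
    v = suc v₀
    difference≃ : toℚᵘ (ratio X Y - ratio P R) ℚᵘ.≃ mkℚᵘ (+ X) y ℚᵘ.- mkℚᵘ (+ P) r
    difference≃ = ℚᵘ.≃-trans (ℚ.toℚᵘ-homo-+ (ratio X Y) (- ratio P R))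
      (ℚᵘ.+-cong (ℚ.toℚᵘ-fromℚᵘ (mkℚᵘ (+ X) y))
                 (ℚᵘ.≃-trans (ℚ.toℚᵘ-homo‿- (ratio P R)) (ℚᵘ.-‿cong (ℚ.toℚᵘ-fromℚᵘ (mkℚᵘ (+ P) r)))))
    PYv = + (P * Y * v)
    lhs≡ : (+ X ℤ.* + R ℤ.+ (ℤ.- + P) ℤ.* + Y) ℤ.* + v ≡ + (X * R * v) ℤ.+ ℤ.- PYv
    lhs≡ = trans (expand (+ X) (+ R) (+ P) (+ Y) (+ v)) (sym (cong₂ (λ s t → s ℤ.+ ℤ.- t) (+-*-+ X R v) (+-*-+ P Y v)))
      where
      expand : ∀ x r p y v → (x ℤ.* r ℤ.+ (ℤ.- p) ℤ.* y) ℤ.* v ≡ x ℤ.* r ℤ.* v ℤ.+ ℤ.- (p ℤ.* y ℤ.* v)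
      expand = ℤSolver.solve-∀
    rhs≡ : + u ℤ.* + (Y * R) ≡ + (Y * (P * v + u * R)) ℤ.+ ℤ.- PYv
    rhs≡ = begin
      + u ℤ.* + (Y * R)                         ≡⟨ ℤ.pos-* u (Y * R) ⟨
      + (u * (Y * R))                           ≡⟨ add-sub (+ (u * (Y * R))) PYv ⟩
      + (u * (Y * R)) ℤ.+ PYv ℤ.+ ℤ.- PYv       ≡⟨ cong (ℤ._+ ℤ.- PYv) (ℤ.pos-+ (u * (Y * R)) _) ⟨
      + (u * (Y * R) + P * Y * v) ℤ.+ ℤ.- PYv   ≡⟨ cong (λ n → + n ℤ.+ ℤ.- PYv) (regroup u Y R P v) ⟩
      + (Y * (P * v + u * R)) ℤ.+ ℤ.- PYv       ∎
      where
      open ≡-Reasoning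
      add-sub : ∀ x t → x ≡ x ℤ.+ t ℤ.+ ℤ.- t
      add-sub = ℤSolver.solve-∀
      regroup : ∀ u Y R P v → u * (Y * R) + P * Y * v ≡ Y * (P * v + u * R)
      regroup = solve-∀
    cleared : (+ X ℤ.* + R ℤ.+ (ℤ.- + P) ℤ.* + Y) ℤ.* + v ℤ.< + u ℤ.* + (Y * R)
    cleared = subst₂ ℤ._<_ (sym lhs≡) (sym rhs≡) (ℤ.+-monoˡ-< (ℤ.- PYv) (ℤ.+<+ XRv<YPvuR))

  ∣ratio-ratio∣< : ∀ X Y P R u₀ v₀ .(c : Coprime (suc u₀) (suc v₀)) → 1 ≤ Y → 1 ≤ R →
                   X * R * suc v₀ < Y * (P * suc v₀ + suc u₀ * R) →
                   P * Y * suc v₀ < R * (X * suc v₀ + suc u₀ * Y) →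
                   ∣ ratio X Y - ratio P R ∣ <ℚ mkℚ +[1+ u₀ ] v₀ c
  ∣ratio-ratio∣< X (suc y) P (suc r) u₀ v₀ c (s≤s _) (s≤s _) above below
    with ℚ.∣p∣≡p∨∣p∣≡-p (ratio X (suc y) - ratio P (suc r))
  ... | inj₁ ∣z∣≡z  = subst (_<ℚ _) (sym ∣z∣≡z) (ratio-ratio-< X y P r u₀ v₀ c above)
  ... | inj₂ ∣z∣≡-z = subst (_<ℚ _) (sym (trans ∣z∣≡-z -[x-y]≡y-x)) (ratio-ratio-< P r X y u₀ v₀ c below)
    where
    -[x-y]≡y-x : - (ratio X (suc y) - ratio P (suc r)) ≡ ratio P (suc r) - ratio X (suc y)
    -[x-y]≡y-x = ⁻¹-anti-homo‿- ℚ.+-0-abelianGroup (ratio X (suc y)) (ratio P (suc r))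

open RatioBounds using (∣ratio-ratio∣<)

-- Asymptotics of greedy expansions

-- The recursion defining d_{p,r}^k, abstracted: with j = j_k^r(m), x m and y m are the a- and b-clique counts
-- of T_{j,s}, and q m = ⌊j / s⌋.
record GreedyExpansion (a₀ b₀ : ℕ) : Set where
  field
    A B K      : ℕ
    A-pos      : 1 ≤ A
    B-pos      : 1 ≤ B
    d x y q    : ℕ → ℕ
    d-zero     : d 0 ≡ 0
    d-step     : ∀ {m} → 1 ≤ m → d m ≡ y m + d (m ∸ x m)
    x-pos      : ∀ {m} → 1 ≤ m → 1 ≤ x m
    x≤m        : ∀ m → x m ≤ m
    x-lower    : ∀ m → A * q m ^ suc a₀ ≤ x m
    m-upper    : ∀ m → m < A * (2 + q m) ^ suc a₀
    rest-upper : ∀ m → m ∸ x m < K * suc (q m) ^ a₀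
    y-lower    : ∀ m → B * q m ^ suc b₀ ≤ y m
    y-upper    : ∀ m → y m ≤ B * suc (q m) ^ suc b₀

module Asymptotics {a₀ b₀} (G : GreedyExpansion a₀ b₀) where
  open GreedyExpansion G

  a b N : ℕ
  a = suc a₀
  b = suc b₀
  N = b * a

  rest<m : ∀ {m} → 1 ≤ m → m ∸ x m < m
  rest<m {m} 1≤m = ∸-monoʳ-< (x-pos 1≤m) (x≤m m)

  y≤d : ∀ {m} → 1 ≤ m → y m ≤ d m
  y≤d {m} 1≤m = subst (y m ≤_) (sym (d-step 1≤m)) (m≤m+n _ _)

  q-large : ∀ Q → Eventually (λ m → Q ≤ q m)
  q-large Q = A * (2 + Q) ^ a , λ m X≤m →
    ≮⇒≥ λ q<Q → <⇒≱ (m-upper m) (≤-trans (*-monoʳ-≤ A (^-monoˡ-≤ a (+-monoʳ-≤ 2 (<⇒≤ q<Q)))) X≤m)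

  eventually-by-q : ∀ {P : ℕ → Set} → ∃[ Q ] (∀ m → 1 ≤ m → Q ≤ q m → P m) → Eventually P
  eventually-by-q (Q , p) = eventually-map (λ (1≤m , Q≤q) → p _ 1≤m Q≤q) (eventually-zip (eventually-≥ 1) (q-large Q))

  ^b^a : ∀ z → (z ^ b) ^ a ≡ z ^ N
  ^b^a z = ^-*-assoc z b a

  ^a^b : ∀ z → (z ^ a) ^ b ≡ z ^ N
  ^a^b z = trans (^-*-assoc z a b) (cong (z ^_) (*-comm a b))

  m^b-lower : ∀ m → A ^ b * q m ^ N ≤ m ^ b
  m^b-lower m = begin
    A ^ b * q m ^ N          ≡⟨ cong (A ^ b *_) (^a^b (q m)) ⟨
    A ^ b * (q m ^ a) ^ b    ≡⟨ ^-distribʳ-* A (q m ^ a) b ⟨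
    (A * q m ^ a) ^ b        ≤⟨ ^-monoˡ-≤ b (≤-trans (x-lower m) (x≤m m)) ⟩
    m ^ b                    ∎
    where open ≤-Reasoning

  m^b-upper : ∀ m → m ^ b ≤ A ^ b * (2 + q m) ^ N
  m^b-upper m = begin
    m ^ b                        ≤⟨ ^-monoˡ-≤ b (<⇒≤ (m-upper m)) ⟩
    (A * (2 + q m) ^ a) ^ b      ≡⟨ ^-distribʳ-* A _ b ⟩
    A ^ b * ((2 + q m) ^ a) ^ b  ≡⟨ cong (A ^ b *_) (^a^b (2 + q m)) ⟩
    A ^ b * (2 + q m) ^ N        ∎
    where open ≤-Reasoning

  rest-index-small : ∀ L → 1 ≤ L → ∃[ Q ] (∀ m → Q ≤ q m → L * suc (q (m ∸ x m)) ≤ suc (q m))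
  rest-index-small L 1≤L = L + (2 * L) ^ a * K , λ m Q≤q →
    base-gap a₀ (q m) (q (m ∸ x m)) A-pos 1≤L Q≤q
      (≤-<-trans (x-lower (m ∸ x m)) (≤-<-trans (x≤m (m ∸ x m)) (rest-upper m)))

  rest-scaled : ∀ L κ m → L * suc (q (m ∸ x m)) ≤ suc (q m) →
                d (m ∸ x m) ≤ κ * suc (q (m ∸ x m)) ^ b → L ^ b * d (m ∸ x m) ≤ κ * suc (q m) ^ b
  rest-scaled L κ m small d′≤ = begin
    L ^ b * d m′                   ≤⟨ *-monoʳ-≤ (L ^ b) d′≤ ⟩
    L ^ b * (κ * suc q′ ^ b)       ≡⟨ x∙yz≈y∙xz (L ^ b) κ _ ⟩
    κ * (L ^ b * suc q′ ^ b)       ≡⟨ cong (κ *_) (^-distribʳ-* L (suc q′) b) ⟨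
    κ * (L * suc q′) ^ b           ≤⟨ *-monoʳ-≤ κ (^-monoˡ-≤ b small) ⟩
    κ * suc (q m) ^ b              ∎
    where
    open ≤-Reasoning
    m′ = m ∸ x m
    q′ = q m′

  -- Strong induction on m. Once q m ≥ Q₂ the remainder has index at most half of q m, so its d is at most
  -- κ (1 + q m)^b / 2, leaving room for y m ≤ B (1 + q m)^b; smaller m are bounded by D.
  d-crude : ∃[ κ ] (∀ m → d m ≤ κ * suc (q m) ^ b)
  d-crude = κ , <-rec (λ m → d m ≤ κ * suc (q m) ^ b) bound
    where
    Q₂ = proj₁ (rest-index-small 2 (s≤s z≤n))
    halved = proj₂ (rest-index-small 2 (s≤s z≤n))
    X = A * (2 + Q₂) ^ a
    D = proj₁ (bounded-upTo d X)
    κ = D + 2 * B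
    bound : ∀ m → (∀ {m′} → m′ < m → d m′ ≤ κ * suc (q m′) ^ b) → d m ≤ κ * suc (q m) ^ b
    bound zero _ = subst (_≤ κ * suc (q 0) ^ b) (sym d-zero) z≤n
    bound m@(suc _) ih with Q₂ ≤? q m
    ... | no  Q₂≰q = begin
      d m                   ≤⟨ proj₂ (bounded-upTo d X) (<⇒≤ m<X) ⟩
      D                     ≤⟨ m≤m+n D (2 * B) ⟩
      κ                     ≤⟨ m≤m*n κ _ {{>-nonZero (^-pos b (s≤s z≤n))}} ⟩
      κ * suc (q m) ^ b     ∎
      where
      open ≤-Reasoning
      m<X : m < X
      m<X = <-≤-trans (m-upper m) (*-monoʳ-≤ A (^-monoˡ-≤ a (+-monoʳ-≤ 2 (<⇒≤ (≰⇒> Q₂≰q)))))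
    ... | yes Q₂≤q = *-cancelˡ-≤ 2 (begin
      2 * d m                         ≡⟨ cong (2 *_) (d-step (s≤s z≤n)) ⟩
      2 * (y m + d m′)                ≡⟨ *-distribˡ-+ 2 (y m) (d m′) ⟩
      2 * y m + 2 * d m′              ≤⟨ +-mono-≤ (*-monoʳ-≤ 2 (y-upper m)) rest≤ ⟩
      2 * (B * P) + κ * P             ≡⟨ cong (_+ κ * P) (*-assoc 2 B P) ⟨
      2 * B * P + κ * P               ≤⟨ +-monoˡ-≤ (κ * P) (*-monoˡ-≤ P (m≤n+m (2 * B) D)) ⟩
      κ * P + κ * P                   ≡⟨ cong (κ * P +_) (+-identityʳ (κ * P)) ⟨
      2 * (κ * P)                     ∎)
      where
      open ≤-Reasoning
      m′ = m ∸ x m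
      P = suc (q m) ^ b
      rest≤ : 2 * d m′ ≤ κ * P
      rest≤ = ≤-trans (*-monoˡ-≤ (d m′) (^-monoʳ-≤ 2 {1} {b} (s≤s z≤n)))
                      (rest-scaled 2 κ m (halved m Q₂≤q) (ih (rest<m (s≤s z≤n))))

  d-refined : ∀ {κ} → (∀ m → d m ≤ κ * suc (q m) ^ b) → ∀ L → 1 ≤ L →
              ∃[ Q ] (∀ m → 1 ≤ m → Q ≤ q m → L ^ b * d m ≤ (B * L ^ b + κ) * suc (q m) ^ b)
  d-refined {κ} crude L 1≤L = Q , refined
    where
    Q = proj₁ (rest-index-small L 1≤L)
    refined : ∀ m → 1 ≤ m → Q ≤ q m → L ^ b * d m ≤ (B * L ^ b + κ) * suc (q m) ^ b
    refined m 1≤m Q≤q = begin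
      L ^ b * d m                    ≡⟨ cong (L ^ b *_) (d-step 1≤m) ⟩
      L ^ b * (y m + d m′)           ≡⟨ *-distribˡ-+ (L ^ b) (y m) (d m′) ⟩
      L ^ b * y m + L ^ b * d m′     ≤⟨ +-mono-≤ (*-monoʳ-≤ (L ^ b) (y-upper m)) rest≤ ⟩
      L ^ b * (B * P) + κ * P        ≡⟨ cong (_+ κ * P) (trans (x∙yz≈y∙xz (L ^ b) B P) (sym (*-assoc B (L ^ b) P))) ⟩
      B * L ^ b * P + κ * P          ≡⟨ *-distribʳ-+ P (B * L ^ b) κ ⟨
      (B * L ^ b + κ) * P            ∎
      where
      open ≤-Reasoning
      m′ = m ∸ x m
      P = suc (q m) ^ b
      rest≤ : L ^ b * d m′ ≤ κ * P
      rest≤ = rest-scaled L κ m (proj₂ (rest-index-small L 1≤L) m Q≤q) (crude m′)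

  -- By d-refined, d ≤ (B + κ / L^b) (1 + q)^b. Choosing L with (B L^b + κ)^a v < L^(ab) (B^a v + w) leaves room
  -- to replace (1 + q)^(ab) by q^(ab) for large q.
  d-upper : ∀ v w → 1 ≤ w → ∃[ Q ] (∀ m → 1 ≤ m → Q ≤ q m → d m ^ a * v < (B ^ a * v + w) * q m ^ N)
  d-upper v w 1≤w = Q₃ ⊔ Q₄ , upper-q
    where
    κ = proj₁ d-crude
    L₀ = proj₁ (eventually-shift-< N (B ^ a * v) w κ 1≤w)
    L = suc L₀
    c′ = B ^ a * v + w
    c₁ = (B * L ^ b + κ) ^ a * v
    c₂ = L ^ N * c′

    c₁<c₂ : c₁ < c₂
    c₁<c₂ = begin-strict
      (B * L ^ b + κ) ^ a * v          ≤⟨ *-monoˡ-≤ v (^-monoˡ-≤ a base≤) ⟩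
      (B * (L + κ) ^ b) ^ a * v        ≡⟨ cong (_* v) (trans (^-distribʳ-* B _ a) (cong (B ^ a *_) (^b^a (L + κ)))) ⟩
      B ^ a * (L + κ) ^ N * v          ≡⟨ xy∙z≈xz∙y (B ^ a) _ v ⟩
      B ^ a * v * (L + κ) ^ N          <⟨ proj₂ (eventually-shift-< N (B ^ a * v) w κ 1≤w) L (n≤1+n L₀) ⟩
      c′ * L ^ N                       ≡⟨ *-comm c′ (L ^ N) ⟩
      c₂                               ∎
      where
      open ≤-Reasoning
      base≤ : B * L ^ b + κ ≤ B * (L + κ) ^ b
      base≤ = begin
        B * L ^ b + κ         ≤⟨ +-monoʳ-≤ (B * L ^ b) (m≤n*m κ B {{>-nonZero B-pos}}) ⟩
        B * L ^ b + B * κ     ≡⟨ *-distribˡ-+ B (L ^ b) κ ⟨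
        B * (L ^ b + κ)       ≤⟨ *-monoʳ-≤ B (^-+-≥ b κ (s≤s z≤n) (s≤s z≤n)) ⟩
        B * (L + κ) ^ b       ∎

    shift< : Eventually (λ z → c₁ * (z + 1) ^ N < c₂ * z ^ N)
    shift< = eventually-map (λ {z} → subst (λ c → c₁ * (z + 1) ^ N < c * z ^ N) (m+[n∸m]≡n (<⇒≤ c₁<c₂)))
                            (eventually-shift-< N c₁ (c₂ ∸ c₁) 1 (m<n⇒0<n∸m c₁<c₂))
    Q₃ = proj₁ shift<
    Q₄ = proj₁ (d-refined {κ} (proj₂ d-crude) L (s≤s z≤n))

    upper-q : ∀ m → 1 ≤ m → Q₃ ⊔ Q₄ ≤ q m → d m ^ a * v < c′ * q m ^ N
    upper-q m 1≤m Q≤q = *-cancelˡ-< (L ^ N) _ _ (begin-strict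
      L ^ N * (d m ^ a * v)                  ≡⟨ cong (_* (d m ^ a * v)) (^b^a L) ⟨
      (L ^ b) ^ a * (d m ^ a * v)            ≡⟨ *-assoc ((L ^ b) ^ a) (d m ^ a) v ⟨
      (L ^ b) ^ a * d m ^ a * v              ≡⟨ cong (_* v) (^-distribʳ-* (L ^ b) (d m) a) ⟨
      (L ^ b * d m) ^ a * v                  ≤⟨ *-monoˡ-≤ v (^-monoˡ-≤ a refined) ⟩
      ((B * L ^ b + κ) * P) ^ a * v          ≡⟨ cong (_* v) (^-distribʳ-* (B * L ^ b + κ) P a) ⟩
      (B * L ^ b + κ) ^ a * P ^ a * v        ≡⟨ xy∙z≈xz∙y ((B * L ^ b + κ) ^ a) (P ^ a) v ⟩
      c₁ * P ^ a                             ≡⟨ cong (c₁ *_) (trans (^b^a (suc (q m))) (cong (_^ N) (+-comm 1 (q m)))) ⟩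
      c₁ * (q m + 1) ^ N                     <⟨ proj₂ shift< (q m) (≤-trans (m≤m⊔n Q₃ Q₄) Q≤q) ⟩
      c₂ * q m ^ N                           ≡⟨ *-assoc (L ^ N) c′ (q m ^ N) ⟩
      L ^ N * (c′ * q m ^ N)                 ∎)
      where
      open ≤-Reasoning
      P = suc (q m) ^ b
      refined : L ^ b * d m ≤ (B * L ^ b + κ) * P
      refined = proj₂ (d-refined {κ} (proj₂ d-crude) L (s≤s z≤n)) m 1≤m (≤-trans (m≤n⊔m Q₃ Q₄) Q≤q)

  d^a-lower : ∀ {m} → 1 ≤ m → B ^ a * q m ^ N ≤ d m ^ a
  d^a-lower {m} 1≤m = begin
    B ^ a * q m ^ N          ≡⟨ cong (B ^ a *_) (^b^a (q m)) ⟨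
    B ^ a * (q m ^ b) ^ a    ≡⟨ ^-distribʳ-* B (q m ^ b) a ⟨
    (B * q m ^ b) ^ a        ≤⟨ ^-monoˡ-≤ a (≤-trans (y-lower m) (y≤d 1≤m)) ⟩
    d m ^ a                  ∎
    where open ≤-Reasoning

  upper : ∀ u v → 1 ≤ u → Eventually (λ m → d m ^ a * A ^ b * v < m ^ b * (B ^ a * v + u * A ^ b))
  upper u v 1≤u = eventually-by-q (Q , bound)
    where
    c′ = B ^ a * v + u * A ^ b
    Q = proj₁ (d-upper v (u * A ^ b) (*-mono-≤ 1≤u (^-pos b A-pos)))
    bound : ∀ m → 1 ≤ m → Q ≤ q m → d m ^ a * A ^ b * v < m ^ b * c′
    bound m 1≤m Q≤q = begin-strict
      d m ^ a * A ^ b * v      ≡⟨ xy∙z≈y∙xz (d m ^ a) (A ^ b) v ⟩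
      A ^ b * (d m ^ a * v)    <⟨ *-monoʳ-< (A ^ b) {{>-nonZero (^-pos b A-pos)}} d^a< ⟩
      A ^ b * (c′ * q m ^ N)   ≡⟨ x∙yz≈y∙xz (A ^ b) c′ (q m ^ N) ⟩
      c′ * (A ^ b * q m ^ N)   ≤⟨ *-monoʳ-≤ c′ (m^b-lower m) ⟩
      c′ * m ^ b               ≡⟨ *-comm c′ (m ^ b) ⟩
      m ^ b * c′               ∎
      where
      open ≤-Reasoning
      d^a< = proj₂ (d-upper v (u * A ^ b) (*-mono-≤ 1≤u (^-pos b A-pos))) m 1≤m Q≤q

  lower : ∀ u v → 1 ≤ u → Eventually (λ m → B ^ a * m ^ b * v < A ^ b * (d m ^ a * v + u * m ^ b))
  lower u v 1≤u = eventually-by-q (Q , bound)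
    where
    c = B ^ a * v
    w = u * A ^ b
    Q = proj₁ (eventually-shift-< N c w 2 (*-mono-≤ 1≤u (^-pos b A-pos)))
    bound : ∀ m → 1 ≤ m → Q ≤ q m → B ^ a * m ^ b * v < A ^ b * (d m ^ a * v + u * m ^ b)
    bound m 1≤m Q≤q = begin-strict
      B ^ a * m ^ b * v                     ≡⟨ xy∙z≈xz∙y (B ^ a) (m ^ b) v ⟩
      c * m ^ b                             ≤⟨ *-monoʳ-≤ c (m^b-upper m) ⟩
      c * (A ^ b * (2 + q m) ^ N)           ≡⟨ x∙yz≈y∙xz c (A ^ b) _ ⟩
      A ^ b * (c * (2 + q m) ^ N)           ≡⟨ cong (λ z → A ^ b * (c * z ^ N)) (+-comm 2 (q m)) ⟩
      A ^ b * (c * (q m + 2) ^ N)           <⟨ *-monoʳ-< (A ^ b) {{>-nonZero (^-pos b A-pos)}} shift< ⟩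
      A ^ b * ((c + w) * q m ^ N)           ≡⟨ cong (A ^ b *_) (*-distribʳ-+ (q m ^ N) c w) ⟩
      A ^ b * (c * q m ^ N + w * q m ^ N)   ≤⟨ *-monoʳ-≤ (A ^ b) (+-mono-≤ main rest) ⟩
      A ^ b * (d m ^ a * v + u * m ^ b)     ∎
      where
      open ≤-Reasoning
      shift< = proj₂ (eventually-shift-< N c w 2 (*-mono-≤ 1≤u (^-pos b A-pos))) (q m) Q≤q
      main : c * q m ^ N ≤ d m ^ a * v
      main = ≤-trans (≤-reflexive (xy∙z≈xz∙y (B ^ a) v (q m ^ N))) (*-monoˡ-≤ v (d^a-lower 1≤m))
      rest : w * q m ^ N ≤ u * m ^ b
      rest = ≤-trans (≤-reflexive (*-assoc u (A ^ b) (q m ^ N))) (*-monoʳ-≤ u (m^b-lower m))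

  ratio-converges : ∀ u₀ v₀ .(c : Coprime (suc u₀) (suc v₀)) →
    Eventually (λ m → ∣ ratio (d m ^ a) (m ^ b) - ratio (B ^ a) (A ^ b) ∣ <ℚ mkℚ +[1+ u₀ ] v₀ c)
  ratio-converges u₀ v₀ c = eventually-map close
    (eventually-zip (eventually-zip (upper (suc u₀) (suc v₀) (s≤s z≤n)) (lower (suc u₀) (suc v₀) (s≤s z≤n)))
                    (eventually-≥ 1))
    where
    close : ∀ {m} → (d m ^ a * A ^ b * suc v₀ < m ^ b * (B ^ a * suc v₀ + suc u₀ * A ^ b)
                   × B ^ a * m ^ b * suc v₀ < A ^ b * (d m ^ a * suc v₀ + suc u₀ * m ^ b)) × 1 ≤ m →
            ∣ ratio (d m ^ a) (m ^ b) - ratio (B ^ a) (A ^ b) ∣ <ℚ mkℚ +[1+ u₀ ] v₀ c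
    close {m} ((above , below) , 1≤m) =
      ∣ratio-ratio∣< (d m ^ a) (m ^ b) (B ^ a) (A ^ b) u₀ v₀ c (^-pos b 1≤m) (^-pos b A-pos) above below

module Cliques (s₀ a₀ : ℕ) (a₀≤s₀ : a₀ ≤ s₀) where
  open PartSizes s₀

  a : ℕ
  a = suc a₀

  cliques : ℕ → ℕ
  cliques n = turan n a s

  cliques-suc : ∀ n → cliques (suc n) ≡ cliques n + cliquesAt n a₀
  cliques-suc n = turan-suc n a₀

  cliques-≤-suc : ∀ n → cliques n ≤ cliques (suc n)
  cliques-≤-suc n = subst (cliques n ≤_) (sym (cliques-suc n)) (m≤m+n _ _)

  cliques-mono : ∀ {m n} → m ≤ n → cliques m ≤ cliques n
  cliques-mono {n = zero}  z≤n = ≤-refl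
  cliques-mono {n = suc n} m≤1+n with m≤n⇒m<n∨m≡n m≤1+n
  ... | inj₁ (s≤s m≤n) = ≤-trans (cliques-mono m≤n) (cliques-≤-suc n)
  ... | inj₂ refl      = ≤-refl

  -- Once a₀ vertices are present, every new vertex closes at least one new a-clique.
  cliques-grow : ∀ i → i ≤ cliques (a₀ + i)
  cliques-grow zero    = z≤n
  cliques-grow (suc i) = begin
    suc i                         ≡⟨ +-comm 1 i ⟩
    i + 1                         ≤⟨ +-mono-≤ (cliques-grow i) (cliquesAt-pos (balanced n) a₀ (m≤m+n a₀ i) (s≤s a₀≤s₀)) ⟩
    cliques n + cliquesAt n a₀    ≡⟨ cliques-suc n ⟨
    cliques (suc n)               ≡⟨ cong cliques (+-suc a₀ i) ⟨
    cliques (a₀ + suc i)          ∎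
    where
    open ≤-Reasoning
    n = a₀ + i

  cliques-≤1 : ∀ {n} → n ≤ a → cliques n ≤ 1
  cliques-≤1 {n} n≤a = begin
    cliques n                  ≡⟨ turan≡esym n a ⟩
    esym a (sizes n)           ≡⟨ esym-≤1 a s (sizes-≤1 (≤-trans n≤a (s≤s a₀≤s₀))) ⟩
    nonzeros (sizes n) C a     ≤⟨ n≤k⇒nCk≤1 (≤-trans (nonzeros-sizes n) n≤a) ⟩
    1                          ∎
    where open ≤-Reasoning

  j : ℕ → ℕ
  j = jfun (suc a) (suc s)

  jAux-spec : ∀ m fuel i → cliques i ≤ m →
    let i′ = jAux (suc a) (suc s) m fuel i in
    cliques i′ ≤ m × (m < cliques (suc i′) ⊎ i′ ≡ fuel + i)
  jAux-spec m zero       i ci≤m = ci≤m , inj₂ refl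
  jAux-spec m (suc fuel) i ci≤m with m <ᵇ cliques (suc i) in m<ᵇ
  ... | true  = ci≤m , inj₁ (<ᵇ⇒< m _ (subst T (sym m<ᵇ) _))
  ... | false with jAux-spec m fuel (suc i) (≮⇒≥ (subst T m<ᵇ ∘ <⇒<ᵇ))
  ...   | ci′≤m , inj₁ m<ci′ = ci′≤m , inj₁ m<ci′
  ...   | ci′≤m , inj₂ i′≡   = ci′≤m , inj₂ (trans i′≡ (+-suc fuel i))

  j-spec : ∀ m → cliques (j m) ≤ m × m < cliques (suc (j m))
  j-spec m with jAux-spec m (m + suc a) 0 z≤n
  ... | cj≤m , inj₁ m<cj′ = cj≤m , m<cj′
  ... | cj≤m , inj₂ j≡    = ⊥-elim (<⇒≱ (<-≤-trans (m<m+n m {2} z<s) (cliques-grow (m + 2))) too-few)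
    where
    fuel≡ : ∀ m a₀ → m + suc (suc a₀) + 0 ≡ a₀ + (m + 2)
    fuel≡ = solve-∀
    too-few : cliques (a₀ + (m + 2)) ≤ m
    too-few = subst (λ i → cliques i ≤ m) (trans j≡ (fuel≡ m a₀)) cj≤m

  a≤j : ∀ {m} → 1 ≤ m → a ≤ j m
  a≤j {m} 1≤m = ≮⇒≥ λ j<a → <⇒≱ (≤-<-trans 1≤m (proj₂ (j-spec m))) (cliques-≤1 j<a)

  cliques-j-pos : ∀ {m} → 1 ≤ m → 1 ≤ cliques (j m)
  cliques-j-pos 1≤m = ≤-trans (subst (λ n → 1 ≤ cliques n) (+-comm a₀ 1) (cliques-grow 1)) (cliques-mono (a≤j 1≤m))

  rest<m : ∀ {m} → 1 ≤ m → m ∸ cliques (j m) < m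
  rest<m {m} 1≤m = ∸-monoʳ-< (cliques-j-pos 1≤m) (proj₁ (j-spec m))

module CliqueExpansion (s₀ a₀ b₀ : ℕ) (a₀≤s₀ : a₀ ≤ s₀) (b₀≤s₀ : b₀ ≤ s₀) where
  open PartSizes s₀
  open Cliques s₀ a₀ a₀≤s₀

  b : ℕ
  b = suc b₀

  d : ℕ → ℕ
  d = dfun (suc b) (suc s) (suc a)

  dAux-fuel : ∀ {f₁ f₂} m → m ≤ f₁ → m ≤ f₂ →
              dAux (suc b) (suc s) (suc a) f₁ m ≡ dAux (suc b) (suc s) (suc a) f₂ m
  dAux-fuel {zero}   {zero}   zero    _ _ = refl
  dAux-fuel {zero}   {suc _}  zero    _ _ = refl
  dAux-fuel {suc _}  {zero}   zero    _ _ = refl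
  dAux-fuel {suc _}  {suc _}  zero    _ _ = refl
  dAux-fuel {suc f₁} {suc f₂} (suc m) (s≤s m≤f₁) (s≤s m≤f₂) =
    cong (turan (j (suc m)) b s +_) (dAux-fuel _ (≤-trans rest≤m m≤f₁) (≤-trans rest≤m m≤f₂))
    where
    rest≤m : suc m ∸ cliques (j (suc m)) ≤ m
    rest≤m = ≤-pred (rest<m (s≤s z≤n))

  d-step : ∀ {m} → 1 ≤ m → d m ≡ turan (j m) b s + d (m ∸ cliques (j m))
  d-step {suc m} 1≤m = cong (turan (j (suc m)) b s +_) (dAux-fuel _ (≤-pred (rest<m 1≤m)) ≤-refl)

  rest<cliquesAt : ∀ m → m ∸ cliques (j m) < cliquesAt (j m) a₀
  rest<cliquesAt m = subst (_≤ cliquesAt (j m) a₀) (+-∸-assoc 1 (proj₁ (j-spec m)))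
    (m≤n+o⇒m∸n≤o (suc m) (cliques (j m)) (subst (m <_) (cliques-suc (j m)) (proj₂ (j-spec m))))

  expansion : GreedyExpansion a₀ b₀
  expansion = record
    { A = s C a ; B = s C b ; K = s C a₀
    ; A-pos = k≤n⇒nCk>0 (s≤s a₀≤s₀) ; B-pos = k≤n⇒nCk>0 (s≤s b₀≤s₀)
    ; d = d ; x = cliques ∘ j ; y = λ m → turan (j m) b s ; q = λ m → Balanced.q (balanced (j m))
    ; d-zero = refl ; d-step = d-step
    ; x-pos = cliques-j-pos ; x≤m = λ m → proj₁ (j-spec m)
    ; x-lower = λ m → turan-lower (balanced (j m)) a
    ; m-upper = λ m → <-≤-trans (proj₂ (j-spec m)) (turan-suc-upper (balanced (j m)) a)
    ; rest-upper = λ m → <-≤-trans (rest<cliquesAt m) (cliquesAt-upper (balanced (j m)) a₀)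
    ; y-lower = λ m → turan-lower (balanced (j m)) b
    ; y-upper = λ m → turan-upper (balanced (j m)) b
    }


theorem3p12 : (r k p : ℕ) → k ≤ r → p < k → 1 < p →
    (ε : ℚ) → 0ℚ <ℚ ε →
    ∃[ M ] ((m : ℕ) → M ≤ m →
      ∣ ratio (dfun p r k m ^ (k ∸ 1)) (m ^ (p ∸ 1))
        - ratio (((r ∸ 1) C (p ∸ 1)) ^ (k ∸ 1)) (((r ∸ 1) C (k ∸ 1)) ^ (p ∸ 1)) ∣
        <ℚ ε)
theorem3p12 _ _ _ (s≤s (s≤s a₀≤s₀)) (s≤s (s≤s b₀<a₀)) (s≤s (s≤s z≤n)) (mkℚ +[1+ u₀ ] v₀ c) _ =
  Asymptotics.ratio-converges (CliqueExpansion.expansion _ _ _ a₀≤s₀ (≤-trans (<⇒≤ b₀<a₀) a₀≤s₀)) u₀ v₀ c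
theorem3p12 _ _ _ (s≤s z≤n) (s≤s z≤n) () _ _
theorem3p12 _ _ _ _ _ _ (mkℚ +0 _ _) (*<* (+<+ ()))
theorem3p12 _ _ _ _ _ _ (mkℚ -[1+ _ ] _ _) (*<* ())
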